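{- Let $R$ be a preorder on a set $\Sigma$ and let $\langle P_R,\tau_R,Q_R\rangle$ be its induced 2PR triple. Then $P_R=Q_R$.
   Context: For a relation $R$, $R(x)=\{y\mid(x,y)\in R\}$ and $R(S)=\bigcup_{x\in S}R(x)$. The 2PR triple induced by $R$ is $\langle P_R,\tau_R,Q_R\rangle$, where: - $P_R=\{\{y\mid R(y)=R(x)\}\mid x\in\Sigma\}$; - $Q_R=\{\{y\mid R^{ -1}(y)=R^{ -1}(x)\}\mid x\in\Sigma\}$; - $\tau_R(B)=\{C\in Q_R\mid C\subseteq R(B)\}$. -}

module Defs where

open import Level using (Level; _⊔_; suc)
open import Data.Product using (∃; _×_)
open import Function.Bundles using (_⇔_)
open import Relation.Unary using (Pred; _≐_; _⊆_)
open import Relation.Binary using (Rel; Reflexive; Transitive)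

-- Subsets of Σ are predicates; equality of subsets is extensional (_≐_).

img : ∀ {a ℓ} {Σ : Set a} → Rel Σ ℓ → Σ → Pred Σ ℓ
img R x y = R x y

invImg : ∀ {a ℓ} {Σ : Set a} → Rel Σ ℓ → Σ → Pred Σ ℓ
invImg R x y = R y x

PBlock : ∀ {a ℓ} {Σ : Set a} → Rel Σ ℓ → Σ → Pred Σ (a ⊔ ℓ)
PBlock R x y = img R y ≐ img R x

QBlock : ∀ {a ℓ} {Σ : Set a} → Rel Σ ℓ → Σ → Pred Σ (a ⊔ ℓ)
QBlock R x y = invImg R y ≐ invImg R x

P_ : ∀ {a ℓ} {Σ : Set a} → Rel Σ ℓ → ∀ {p} → Pred (Pred Σ p) (a ⊔ ℓ ⊔ p)
P_ R B = ∃ λ x → B ≐ PBlock R x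

Q_ : ∀ {a ℓ} {Σ : Set a} → Rel Σ ℓ → ∀ {p} → Pred (Pred Σ p) (a ⊔ ℓ ⊔ p)
Q_ R C = ∃ λ x → C ≐ QBlock R x

imgSet : ∀ {a ℓ p} {Σ : Set a} → Rel Σ ℓ → Pred Σ p → Pred Σ (a ⊔ ℓ ⊔ p)
imgSet R S y = ∃ λ x → S x × R x y

τ_ : ∀ {a ℓ} {Σ : Set a} → Rel Σ ℓ → ∀ {p} → Pred Σ p → Pred (Pred Σ p) (a ⊔ ℓ ⊔ p)
τ_ R B C = Q_ R C × (C ⊆ imgSet R B)

IsPreorderRel : ∀ {a ℓ} {Σ : Set a} → Rel Σ ℓ → Set (a ⊔ ℓ)
IsPreorderRel R = Reflexive R × Transitive R

-- In a preorder, R(y) = R(x) and R⁻¹(y) = R⁻¹(x) both say exactly that x and y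
-- are mutually related (reflexivity gives one direction, transitivity the other).
-- So every P-block coincides with the Q-block of the same representative, and the
-- two families of blocks are the same.
module Submission where

open import Defs
open import Data.Product using (∃; _×_; _,_; proj₁; proj₂; map₂)
open import Function using (_∘_)
open import Function.Bundles using (_⇔_; mk⇔)
open import Relation.Unary using (Pred; _≐_)
open import Relation.Unary.Properties using (≐-sym; ≐-trans)
open import Relation.Binary using (Rel; Reflexive; Transitive)

module _ {a ℓ} {Σ : Set a} {R : Rel Σ ℓ} (isPreorder : IsPreorderRel R) where

  private
    refl : Reflexive R
    refl = proj₁ isPreorder

    trans : Transitive R
    trans = proj₂ isPreorder

  Mutual : Σ → Σ → Set ℓ
  Mutual x y = R x y × R y x

  PBlock⇒mutual : ∀ {x y} → PBlock R x y → Mutual x y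
  PBlock⇒mutual (Ry⊆Rx , Rx⊆Ry) = Ry⊆Rx refl , Rx⊆Ry refl

  mutual⇒PBlock : ∀ {x y} → Mutual x y → PBlock R x y
  mutual⇒PBlock (Rxy , Ryx) = (λ Ryz → trans Rxy Ryz) , (λ Rxz → trans Ryx Rxz)

  QBlock⇒mutual : ∀ {x y} → QBlock R x y → Mutual x y
  QBlock⇒mutual (R⁻¹y⊆R⁻¹x , R⁻¹x⊆R⁻¹y) = R⁻¹x⊆R⁻¹y refl , R⁻¹y⊆R⁻¹x refl

  mutual⇒QBlock : ∀ {x y} → Mutual x y → QBlock R x y
  mutual⇒QBlock (Rxy , Ryx) = (λ Rzy → trans Rzy Ryx) , (λ Rzx → trans Rzx Rxy)

  PBlock≐QBlock : ∀ x → PBlock R x ≐ QBlock R x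
  PBlock≐QBlock x = mutual⇒QBlock ∘ PBlock⇒mutual , mutual⇒PBlock ∘ QBlock⇒mutual

blockFamily-cong : ∀ {a b p q r} {I : Set a} {Σ : Set b} {F : I → Pred Σ q} {G : I → Pred Σ r} →
                   (∀ i → F i ≐ G i) → (B : Pred Σ p) →
                   (∃ λ i → B ≐ F i) ⇔ (∃ λ i → B ≐ G i)
blockFamily-cong F≐G B = mk⇔ (map₂ (λ {i} B≐Fi → ≐-trans B≐Fi (F≐G i)))
                             (map₂ (λ {i} B≐Gi → ≐-trans B≐Gi (≐-sym (F≐G i))))

mainTheorem11 : ∀ {a ℓ} {Σ : Set a} (R : Rel Σ ℓ) → IsPreorderRel R →
                ∀ {p} (B : Pred Σ p) → (P_ R B ⇔ Q_ R B)
mainTheorem11 R isPreorder = blockFamily-cong (PBlock≐QBlock isPreorder)
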